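{- Let $n\ge 2$, let $Q_{4n}=\langle x,y: x^n=y^2,\ x^{2n}=e,\ y^{ -1}xy=x^{ -1}\rangle$, and let $t$ be a positive integer dividing $2n$. Then the proper subgroup $\langle x^t\rangle$ of $Q_{4n}$ is a perfect code of $Q_{4n}$ if and only if $2n/t$ is odd. Moreover, if $2n/t$ is odd, then $\mathrm{Cay}(Q_{4n},S)$ admits $\langle x^t\rangle$ as a perfect code, where $S=\{x^n, x^i, x^{ -i}: 1\le i\le t/2-1\}\cup\{x^i y, x^{n+i}y: 0\le i\le t/2-1\}$.
   Context: For a group $G$ and an inverse-closed subset $S\subseteq G$ with $e\notin S$, the Cayley graph $\mathrm{Cay}(G,S)$ has vertex set $G$, with distinct $u,v$ adjacent iff $vu^{ -1}\in S$. A subset $C$ of the vertex set of a graph is a perfect code if it is independent and every vertex outside $C$ is adjacent to exactly one vertex of $C$. A subset $C$ of $G$ is a perfect code of $G$ if some Cayley graph $\mathrm{Cay}(G,S)$ admits $C$ as a perfect code. -}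

module Defs where

open import Data.Nat using (ℕ; zero; suc; _+_; _*_; _∸_; _<_; _≤_; NonZero)
open import Data.Nat.Properties using (m*n≢0)
open import Data.Nat.DivMod using (_mod_)
open import Data.Fin using (Fin; toℕ)
open import Data.Bool using (Bool; true; false; _∧_; _xor_)
open import Data.Product using (_×_; _,_; ∃-syntax)
open import Data.Sum using (_⊎_)
open import Relation.Nullary using (¬_)
open import Relation.Binary.PropositionalEquality using (_≡_; _≢_)

module CayleyNotions {G : Set} (_·_ : G → G → G) (e : G) (inv : G → G) where

  pow : G → ℕ → G
  pow g zero    = e
  pow g (suc k) = pow g k · g

  ⟨_⟩ : G → G → Set
  ⟨ h ⟩ g = ∃[ k ] pow h k ≡ g

  InverseClosed : (G → Set) → Set
  InverseClosed S = ∀ g → S g → S (inv g)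

  Adj : (G → Set) → G → G → Set
  Adj S u v = (u ≢ v) × S (v · inv u)

  IsPerfectCode : (G → Set) → (G → Set) → Set
  IsPerfectCode S C =
    (∀ u v → C u → C v → ¬ Adj S u v) ×
    (∀ v → ¬ C v → ∃[ c ] (C c × Adj S v c × (∀ c′ → C c′ → Adj S v c′ → c′ ≡ c)))

  IsPerfectCodeOfGroup : (G → Set) → Set₁
  IsPerfectCodeOfGroup C =
    ∃[ S ] (InverseClosed S × ¬ S e × IsPerfectCode S C)

-- The dicyclic (generalised quaternion) group
--   Q_{4n} = ⟨ x, y ∣ x^n = y^2, x^{2n} = e, y⁻¹ x y = x⁻¹ ⟩,
-- realised concretely: the pair (a , b) stands for x^a y^b,
-- a ∈ ℤ/2n, b ∈ {0,1} (false = 0, true = 1).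

module Dicyclic (n : ℕ) .{{_ : NonZero n}} where

  N : ℕ
  N = 2 * n

  instance
    N≢0 : NonZero N
    N≢0 = m*n≢0 2 n

  Q : Set
  Q = Fin N × Bool

  red : ℕ → Fin N
  red k = k mod N

  e : Q
  e = red 0 , false

  -- x^a y^b · x^c y^d = x^(a + (-1)^b c + [b∧d] n) y^(b+d)
  _·_ : Q → Q → Q
  (a , b) · (c , d) =
    red (toℕ a + sgn b + (if b ∧ d then n else 0)) , (b xor d)
    where
      if_then_else_ : Bool → ℕ → ℕ → ℕ
      if true  then p else q = p
      if false then p else q = q
      sgn : Bool → ℕ
      sgn false = toℕ c
      sgn true  = N ∸ toℕ c

  -- (x^a)⁻¹ = x^(-a),  (x^a y)⁻¹ = x^(a+n) y
  inv : Q → Q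
  inv (a , false) = red (N ∸ toℕ a) , false
  inv (a , true)  = red (toℕ a + n) , true

  x : Q
  x = red 1 , false

  y : Q
  y = red 0 , true

  open CayleyNotions _·_ e inv public

  -- S = {x^n, x^i, x^{-i} : 1 ≤ i ≤ t/2 - 1} ∪ {x^i y, x^{n+i} y : 0 ≤ i ≤ t/2 - 1}
  -- (here "half" is t/2; i ≤ t/2 - 1 is written i < t/2)
  Sset : (half : ℕ) → Q → Set
  Sset half g =
    (g ≡ pow x n)
    ⊎ (∃[ i ] (1 ≤ i × i < half × (g ≡ pow x i ⊎ g ≡ inv (pow x i))))
    ⊎ (∃[ i ] (i < half × (g ≡ pow x i · y ⊎ g ≡ pow x (n + i) · y)))

module Submission where

-- For t ∣ 2n the right cosets of H = ⟨x^t⟩ are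
-- labelled by (b , a mod t), and H is a perfect code of Cay(G , S) as soon as S
-- avoids H and meets every other right coset exactly once.  When 2n/t is odd,
-- t = 2h and n ≡ h (mod t), and the given S has exactly one element of each label
-- other than that of H.  When t ∣ n, let c ∈ H be the neighbour of y ∉ H in a
-- perfect code H of Cay(G , S); since S = S⁻¹, also (c y⁻¹)⁻¹ y = c xⁿ ∈ H is a
-- neighbour of y, and it differs from c because xⁿ ≠ e.

open import Defs
open import Data.Bool using (Bool; true; false)
open import Data.Fin using (toℕ)
open import Data.Fin.Properties using (toℕ-fromℕ<; toℕ-injective; toℕ<n)
open import Data.Nat using (ℕ; zero; suc; s≤s; _+_; _*_; _∸_; _/_; _%_; _≤_; _<_; NonZero; ≢-nonZero⁻¹; >-nonZero⁻¹)
open import Data.Nat.Divisibility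
open import Data.Nat.DivMod
open import Data.Nat.Primality using (euclidsLemma; prime[2])
open import Data.Nat.Properties
open import Data.Nat.Tactic.RingSolver using (solve-∀)
open import Data.Product using (_×_; _,_; proj₁; proj₂; ∃-syntax)
open import Data.Sum using (inj₁; inj₂)
open import Function using (_∘_)
open import Function.Bundles using (_⇔_; mk⇔)
open import Relation.Binary.Bundles using (Setoid)
open import Relation.Binary.Definitions using (tri<; tri≈; tri>)
open import Relation.Binary.PropositionalEquality
import Relation.Binary.Reasoning.Setoid as SetoidReasoning
open import Relation.Nullary using (¬_; yes; no; contradiction)

module Congruence (d : ℕ) .{{_ : NonZero d}} where

  infix 4 _≋_
  _≋_ : ℕ → ℕ → Set
  a ≋ b = a % d ≡ b % d

  ≋-setoid : Setoid _ _
  ≋-setoid = record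
    { Carrier = ℕ ; _≈_ = _≋_
    ; isEquivalence = record { refl = refl ; sym = sym ; trans = trans } }

  module ≋-Reasoning = SetoidReasoning ≋-setoid

  %-≋ : ∀ a → a % d ≋ a
  %-≋ a = m%n%n≡m%n a d

  ∣⇒≋0 : ∀ {a} → d ∣ a → a ≋ 0
  ∣⇒≋0 {a} d∣a = trans (n∣m⇒m%n≡0 a d d∣a) (sym (n∣m⇒m%n≡0 0 d (d ∣0)))

  ≋0⇒∣ : ∀ {a} → a ≋ 0 → d ∣ a
  ≋0⇒∣ {a} a≋0 = m%n≡0⇒n∣m a d (trans a≋0 (n∣m⇒m%n≡0 0 d (d ∣0)))

  d≋0 : d ≋ 0
  d≋0 = ∣⇒≋0 ∣-refl

  +-cong : ∀ {a b c e} → a ≋ b → c ≋ e → a + c ≋ b + e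
  +-cong {a} {b} {c} {e} a≋b c≋e = trans (%-distribˡ-+ a c d)
    (trans (cong₂ (λ u v → (u + v) % d) a≋b c≋e) (sym (%-distribˡ-+ b e d)))

  +-congˡ : ∀ a {b c} → b ≋ c → a + b ≋ a + c
  +-congˡ a = +-cong {a} refl

  +-congʳ : ∀ c {a b} → a ≋ b → a + c ≋ b + c
  +-congʳ c a≋b = +-cong a≋b (refl {x = c % d})

  ∸-inverse : ∀ {a} → a ≤ d → (d ∸ a) + a ≋ 0
  ∸-inverse a≤d = trans (cong (_% d) (m∸n+n≡m a≤d)) d≋0

  +-cancelˡ : ∀ a {b c} → a + b ≋ a + c → b ≋ c
  +-cancelˡ a {b} {c} eq = begin
    b                 ≈⟨ +-congʳ b (sym a⁻+a≋0) ⟩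
    (a⁻ + a) + b      ≡⟨ +-assoc a⁻ a b ⟩
    a⁻ + (a + b)      ≈⟨ +-congˡ a⁻ eq ⟩
    a⁻ + (a + c)      ≡⟨ +-assoc a⁻ a c ⟨
    (a⁻ + a) + c      ≈⟨ +-congʳ c a⁻+a≋0 ⟩
    c                 ∎
    where
    open ≋-Reasoning
    a⁻ : ℕ
    a⁻ = d ∸ a % d
    a⁻+a≋0 : a⁻ + a ≋ 0
    a⁻+a≋0 = trans (+-congˡ a⁻ (sym (%-≋ a))) (∸-inverse (m%n≤n a d))

  +-cancelʳ : ∀ a {b c} → b + a ≋ c + a → b ≋ c
  +-cancelʳ a {b} {c} eq =
    +-cancelˡ a (trans (cong (_% d) (+-comm a b)) (trans eq (cong (_% d) (+-comm c a))))

≋-weaken : ∀ {m d} .{{_ : NonZero m}} .{{_ : NonZero d}} → m ∣ d →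
           ∀ {a b} → Congruence._≋_ d a b → Congruence._≋_ m a b
≋-weaken {m} {d} m∣d {a} {b} a≋b =
  trans (sym (m∣n⇒o%n%m≡o%m m d a m∣d)) (trans (cong (_% m) a≋b) (m∣n⇒o%n%m≡o%m m d b m∣d))

¬2∣⇒%2≡1 : ∀ {m} → ¬ 2 ∣ m → m % 2 ≡ 1
¬2∣⇒%2≡1 {m} 2∤m with m % 2 | m%n<n m 2 | m%n≡0⇒n∣m m 2
... | zero        | _             | 2∣m = contradiction (2∣m refl) 2∤m
... | suc zero    | _             | _   = refl
... | suc (suc _) | s≤s (s≤s ()) | _

even-quotient : ∀ n t m → 2 * n ≡ m * t → 2 ∣ m → t ∣ n
even-quotient n t .(k * 2) 2n≡2kt (divides k refl) =
  divides k (*-cancelˡ-≡ n (k * t) 2 (trans 2n≡2kt (regroup k t)))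
  where
  regroup : ∀ k t → k * 2 * t ≡ 2 * (k * t)
  regroup = solve-∀

odd-quotient : ∀ n t m → 2 * n ≡ m * t → ¬ 2 ∣ m → ∃[ h ] ∃[ q ] (t ≡ h + h × n ≡ q * t + h)
odd-quotient n t m 2n≡mt 2∤m with euclidsLemma m t prime[2] (divides n (trans (sym 2n≡mt) (*-comm 2 n)))
... | inj₁ 2∣m = contradiction 2∣m 2∤m
... | inj₂ (divides h refl) = h , q , double h , *-cancelˡ-≡ n (q * (h * 2) + h) 2 (begin
  2 * n                      ≡⟨ 2n≡mt ⟩
  m * (h * 2)                ≡⟨ cong (_* (h * 2)) (m≡m%n+[m/n]*n m 2) ⟩
  (m % 2 + q * 2) * (h * 2)  ≡⟨ cong (λ r → (r + q * 2) * (h * 2)) (¬2∣⇒%2≡1 2∤m) ⟩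
  (1 + q * 2) * (h * 2)      ≡⟨ expand q h ⟩
  2 * (q * (h * 2) + h)      ∎)
  where
  open ≡-Reasoning
  q : ℕ
  q = m / 2
  double : ∀ h → h * 2 ≡ h + h
  double = solve-∀
  expand : ∀ q h → (1 + q * 2) * (h * 2) ≡ 2 * (q * (h * 2) + h)
  expand = solve-∀

[h+h]/2≡h : ∀ h → (h + h) / 2 ≡ h
[h+h]/2≡h h = trans (cong (_/ 2) (trans (cong (h +_) (sym (+-identityʳ h))) (*-comm 2 h))) (m*n/n≡m h 2)

module CosetLabelling {G : Set} (_·_ : G → G → G) (e : G) (inv : G → G)
  (inv-involutive : ∀ g → inv (inv g) ≡ g)
  (inv-cancelʳ : ∀ g w → (g · inv w) · w ≡ g) where

  open CayleyNotions _·_ e inv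

  cancelʳ-inv : ∀ g w → (g · w) · inv w ≡ g
  cancelʳ-inv g w = subst (λ w′ → (g · w′) · inv w ≡ g) (inv-involutive w) (inv-cancelʳ g (inv w))

  reflected-neighbour : ∀ {S C} → InverseClosed S → IsPerfectCode S C → ∀ v → ¬ C v →
    ∃[ c ] (C c × (C (inv (c · inv v) · v) → inv (c · inv v) · v ≡ c))
  reflected-neighbour {S} {C} S⁻¹⊆S (_ , cover) v v∉C with cover v v∉C
  ... | c , c∈C , (_ , s∈S) , unique = c , c∈C , λ c′∈C →
    unique _ c′∈C ((λ v≡c′ → v∉C (subst C (sym v≡c′) c′∈C))
                  , subst S (sym (cancelʳ-inv _ v)) (S⁻¹⊆S _ s∈S))

  module Labelling {K : Set} (κ : G → K) {C S : G → Set}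
    (κ-code : ∀ {g} → C g → κ g ≡ κ e)
    (code-κ : ∀ {g} → κ g ≡ κ e → C g)
    (κ-translate : ∀ {c} w → C c → κ (c · w) ≡ κ w)
    (κ-coset : ∀ {g w} → κ g ≡ κ w → C (g · inv w))
    (κ-S : ∀ {s} → S s → κ s ≢ κ e)
    (S-injective : ∀ {s s′} → S s → S s′ → κ s ≡ κ s′ → s ≡ s′)
    (S-surjective : ∀ w → κ w ≢ κ e → ∃[ s ] (S s × κ s ≡ κ w)) where

    e∉S : ¬ S e
    e∉S e∈S = κ-S e∈S refl

    code-inv : ∀ {g} → C g → C (inv g)
    code-inv {g} g∈C = code-κ (begin
      κ (inv g)       ≡⟨ κ-translate (inv g) g∈C ⟨
      κ (g · inv g)   ≡⟨ κ-code (κ-coset refl) ⟩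
      κ e             ∎)
      where open ≡-Reasoning

    κ-inv-outside : ∀ {v} → ¬ C v → κ (inv v) ≢ κ e
    κ-inv-outside {v} v∉C κv⁻¹≡κe = v∉C (subst C (inv-involutive v) (code-inv (code-κ κv⁻¹≡κe)))

    isPerfectCode : IsPerfectCode S C
    isPerfectCode = independent , cover
      where
      independent : ∀ u v → C u → C v → ¬ Adj S u v
      independent u v u∈C v∈C (_ , s∈S) =
        κ-S s∈S (κ-code (κ-coset (trans (κ-code v∈C) (sym (κ-code u∈C)))))
      cover : ∀ v → ¬ C v → ∃[ c ] (C c × Adj S v c × (∀ c′ → C c′ → Adj S v c′ → c′ ≡ c))
      cover v v∉C with S-surjective (inv v) (κ-inv-outside v∉C)
      ... | s , s∈S , κs≡κw = c , c∈C , (v≢c , subst S (sym (inv-cancelʳ s w)) s∈S) , unique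
        where
        w : G
        w = inv v
        c : G
        c = s · inv w
        c∈C : C c
        c∈C = κ-coset κs≡κw
        v≢c : v ≢ c
        v≢c v≡c = v∉C (subst C (sym v≡c) c∈C)
        unique : ∀ c′ → C c′ → Adj S v c′ → c′ ≡ c
        unique c′ c′∈C (_ , c′w∈S) = begin
          c′                ≡⟨ cancelʳ-inv c′ w ⟨
          (c′ · w) · inv w  ≡⟨ cong (_· inv w) (S-injective c′w∈S s∈S (trans (κ-translate w c′∈C) (sym κs≡κw))) ⟩
          s · inv w         ∎
          where open ≡-Reasoning

module DicyclicArithmetic (n : ℕ) .{{_ : NonZero n}} where

  open Dicyclic n
  open Congruence N

  exp : Q → ℕ
  exp g = toℕ (proj₁ g)

  exp-red : ∀ k → toℕ (red k) ≋ k
  exp-red k = trans (cong (_% N) (toℕ-fromℕ< _)) (%-≋ k)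

  exp-injective : ∀ {g h} → proj₂ g ≡ proj₂ h → exp g ≋ exp h → g ≡ h
  exp-injective {a , b} {c , .b} refl a≋c = cong (_, b) (toℕ-injective
    (trans (sym (m<n⇒m%n≡m (toℕ<n a))) (trans a≋c (m<n⇒m%n≡m (toℕ<n c)))))

  n+n≋0 : n + n ≋ 0
  n+n≋0 = trans (cong (λ m → (n + m) % N) (sym (+-identityʳ n))) d≋0

  exp-·ˣ : ∀ a g → exp ((a , false) · g) ≋ toℕ a + exp g
  exp-·ˣ a g = trans (exp-red _) (cong (_% N) (+-identityʳ _))

  exp-invˣ : ∀ a → exp (inv (a , false)) + toℕ a ≋ 0
  exp-invˣ a = trans (+-congʳ (toℕ a) (exp-red _)) (∸-inverse (<⇒≤ (toℕ<n a)))

  exp-invʸ : ∀ a → exp (inv (a , true)) ≋ toℕ a + n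
  exp-invʸ a = exp-red _

  -- The products with a leading y are stated with the subtracted exponent moved to
  -- the left, so that no truncated subtraction appears.
  exp-·ʸˣ : ∀ a c → exp ((a , true) · (c , false)) + toℕ c ≋ toℕ a
  exp-·ʸˣ a c = begin
    exp ((a , true) · (c , false)) + toℕ c  ≈⟨ +-congʳ (toℕ c) (exp-red _) ⟩
    toℕ a + (N ∸ toℕ c) + 0 + toℕ c        ≡⟨ rearrange (toℕ a) (N ∸ toℕ c) (toℕ c) ⟩
    toℕ a + ((N ∸ toℕ c) + toℕ c)          ≈⟨ +-congˡ (toℕ a) (∸-inverse (<⇒≤ (toℕ<n c))) ⟩
    toℕ a + 0                              ≡⟨ +-identityʳ (toℕ a) ⟩
    toℕ a                                  ∎
    where
    open ≋-Reasoning
    rearrange : ∀ a b c → a + b + 0 + c ≡ a + (b + c)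
    rearrange = solve-∀

  exp-·ʸʸ : ∀ a c → exp ((a , true) · (c , true)) + toℕ c ≋ toℕ a + n
  exp-·ʸʸ a c = begin
    exp ((a , true) · (c , true)) + toℕ c  ≈⟨ +-congʳ (toℕ c) (exp-red _) ⟩
    toℕ a + (N ∸ toℕ c) + n + toℕ c       ≡⟨ rearrange (toℕ a) (N ∸ toℕ c) n (toℕ c) ⟩
    (toℕ a + n) + ((N ∸ toℕ c) + toℕ c)   ≈⟨ +-congˡ (toℕ a + n) (∸-inverse (<⇒≤ (toℕ<n c))) ⟩
    toℕ a + n + 0                         ≡⟨ +-identityʳ (toℕ a + n) ⟩
    toℕ a + n                             ∎
    where
    open ≋-Reasoning
    rearrange : ∀ a b n c → a + b + n + c ≡ (a + n) + (b + c)
    rearrange = solve-∀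

  inv-involutive : ∀ g → inv (inv g) ≡ g
  inv-involutive (a , false) = exp-injective refl (+-cancelʳ (exp (inv (a , false)))
    (trans (exp-invˣ _) (sym (trans (cong (_% N) (+-comm (toℕ a) _)) (exp-invˣ a)))))
  inv-involutive (a , true) = exp-injective refl (begin
    exp (inv (inv (a , true)))  ≈⟨ exp-invʸ _ ⟩
    exp (inv (a , true)) + n    ≈⟨ +-congʳ n (exp-invʸ a) ⟩
    toℕ a + n + n               ≡⟨ +-assoc (toℕ a) n n ⟩
    toℕ a + (n + n)             ≈⟨ +-congˡ (toℕ a) n+n≋0 ⟩
    toℕ a + 0                   ≡⟨ +-identityʳ (toℕ a) ⟩
    toℕ a                       ∎)
    where open ≋-Reasoning

  inv-cancelʳ : ∀ g w → (g · inv w) · w ≡ g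
  inv-cancelʳ (a , false) (c , false) = exp-injective refl (begin
    exp (u · (c , false))        ≈⟨ exp-·ˣ _ (c , false) ⟩
    exp u + toℕ c                ≈⟨ +-congʳ (toℕ c) (exp-·ˣ a w⁻¹) ⟩
    toℕ a + exp w⁻¹ + toℕ c      ≡⟨ +-assoc (toℕ a) (exp w⁻¹) (toℕ c) ⟩
    toℕ a + (exp w⁻¹ + toℕ c)    ≈⟨ +-congˡ (toℕ a) (exp-invˣ c) ⟩
    toℕ a + 0                    ≡⟨ +-identityʳ (toℕ a) ⟩
    toℕ a                        ∎)
    where
    open ≋-Reasoning
    w⁻¹ u : Q
    w⁻¹ = inv (c , false)
    u = (a , false) · w⁻¹
  inv-cancelʳ (a , false) (c , true) = exp-injective refl (+-cancelʳ (toℕ c) (begin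
    exp (u · (c , true)) + toℕ c  ≈⟨ exp-·ʸʸ _ c ⟩
    exp u + n                     ≈⟨ +-congʳ n (exp-·ˣ a w⁻¹) ⟩
    toℕ a + exp w⁻¹ + n           ≈⟨ +-congʳ n (+-congˡ (toℕ a) (exp-invʸ c)) ⟩
    toℕ a + (toℕ c + n) + n       ≡⟨ rearrange (toℕ a) (toℕ c) n ⟩
    toℕ a + toℕ c + (n + n)       ≈⟨ +-congˡ (toℕ a + toℕ c) n+n≋0 ⟩
    toℕ a + toℕ c + 0             ≡⟨ +-identityʳ (toℕ a + toℕ c) ⟩
    toℕ a + toℕ c                 ∎))
    where
    open ≋-Reasoning
    w⁻¹ u : Q
    w⁻¹ = inv (c , true)
    u = (a , false) · w⁻¹
    rearrange : ∀ a c n → a + (c + n) + n ≡ a + c + (n + n)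
    rearrange = solve-∀
  inv-cancelʳ (a , true) (c , false) = exp-injective refl (begin
    exp (u · (c , false))                      ≡⟨ +-identityʳ _ ⟨
    exp (u · (c , false)) + 0                  ≈⟨ +-congˡ (exp (u · (c , false))) (exp-invˣ c) ⟨
    exp (u · (c , false)) + (exp w⁻¹ + toℕ c)  ≡⟨ rearrange (exp (u · (c , false))) (exp w⁻¹) (toℕ c) ⟩
    exp (u · (c , false)) + toℕ c + exp w⁻¹    ≈⟨ +-congʳ (exp w⁻¹) (exp-·ʸˣ _ c) ⟩
    exp u + exp w⁻¹                            ≈⟨ exp-·ʸˣ a _ ⟩
    toℕ a                                      ∎)
    where
    open ≋-Reasoning
    w⁻¹ u : Q
    w⁻¹ = inv (c , false)
    u = (a , true) · w⁻¹
    rearrange : ∀ x i c → x + (i + c) ≡ x + c + i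
    rearrange = solve-∀
  inv-cancelʳ (a , true) (c , true) = exp-injective refl (+-cancelʳ n (begin
    exp (u · (c , true)) + n      ≈⟨ +-congʳ n (exp-·ˣ _ (c , true)) ⟩
    exp u + toℕ c + n             ≡⟨ +-assoc (exp u) (toℕ c) n ⟩
    exp u + (toℕ c + n)           ≈⟨ +-congˡ (exp u) (exp-invʸ c) ⟨
    exp u + exp w⁻¹               ≈⟨ exp-·ʸʸ a _ ⟩
    toℕ a + n                     ∎))
    where
    open ≋-Reasoning
    w⁻¹ u : Q
    w⁻¹ = inv (c , true)
    u = (a , true) · w⁻¹

  pow-red : ∀ a k → pow (red a , false) k ≡ (red (k * a) , false)
  pow-red a zero = refl
  pow-red a (suc k) = begin
    pow (red a , false) k · (red a , false)  ≡⟨ cong (_· (red a , false)) (pow-red a k) ⟩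
    (red (k * a) , false) · (red a , false)  ≡⟨ exp-injective refl exps ⟩
    (red (suc k * a) , false)                ∎
    where
    open ≡-Reasoning
    exps : exp ((red (k * a) , false) · (red a , false)) ≋ toℕ (red (suc k * a))
    exps = trans (exp-·ˣ (red (k * a)) (red a , false)) (trans (+-cong (exp-red (k * a)) (exp-red a))
             (trans (cong (_% N) (+-comm (k * a) a)) (sym (exp-red (suc k * a)))))

  pow-x : ∀ k → pow x k ≡ (red k , false)
  pow-x k = trans (pow-red 1 k) (cong (λ m → red m , false) (*-identityʳ k))

  pow-x·y : ∀ k → pow x k · y ≡ (red k , true)
  pow-x·y k = trans (cong (_· y) (pow-x k)) (exp-injective refl
    (trans (exp-·ˣ (red k) y) (trans (+-congˡ (toℕ (red k)) (exp-red 0))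
      (cong (_% N) (+-identityʳ _)))))

  inv-xⁿ : inv (pow x n) ≡ pow x n
  inv-xⁿ = begin
    inv (pow x n)        ≡⟨ cong inv (pow-x n) ⟩
    inv (red n , false)  ≡⟨ exp-injective refl (+-cancelʳ (toℕ (red n)) (trans (exp-invˣ (red n))
                              (sym (trans (+-cong (exp-red n) (exp-red n)) n+n≋0)))) ⟩
    (red n , false)      ≡⟨ pow-x n ⟨
    pow x n              ∎
    where open ≡-Reasoning

  inv-xᵏy : ∀ k → inv (pow x k · y) ≡ pow x (n + k) · y
  inv-xᵏy k = begin
    inv (pow x k · y)      ≡⟨ cong inv (pow-x·y k) ⟩
    inv (red k , true)     ≡⟨ exp-injective refl (trans (exp-invʸ (red k)) (trans (+-congʳ n (exp-red k))
                                (trans (cong (_% N) (+-comm k n)) (sym (exp-red (n + k)))))) ⟩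
    (red (n + k) , true)   ≡⟨ pow-x·y (n + k) ⟨
    pow x (n + k) · y      ∎
    where open ≡-Reasoning

  [xᵃy⁻¹]⁻¹y≡xᵃ⁺ⁿ : ∀ a → inv ((a , false) · inv y) · y ≡ (red (toℕ a + n) , false)
  [xᵃy⁻¹]⁻¹y≡xᵃ⁺ⁿ a = exp-injective refl (+-cancelʳ z (begin
    exp (inv u · y) + z          ≈⟨ exp-·ʸʸ (proj₁ (inv u)) (red 0) ⟩
    exp (inv u) + n              ≈⟨ +-congʳ n (exp-invʸ (proj₁ u)) ⟩
    exp u + n + n                ≈⟨ +-congʳ n (+-congʳ n (exp-·ˣ a (inv y))) ⟩
    toℕ a + exp (inv y) + n + n  ≈⟨ +-congʳ n (+-congʳ n (+-congˡ (toℕ a) (exp-invʸ (red 0)))) ⟩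
    toℕ a + (z + n) + n + n      ≡⟨ rearrange (toℕ a) z n ⟩
    toℕ a + n + z + (n + n)      ≈⟨ +-congˡ (toℕ a + n + z) n+n≋0 ⟩
    toℕ a + n + z + 0            ≡⟨ +-identityʳ _ ⟩
    toℕ a + n + z                ≈⟨ +-congʳ z (exp-red (toℕ a + n)) ⟨
    toℕ (red (toℕ a + n)) + z    ∎))
    where
    open ≋-Reasoning
    z : ℕ
    z = toℕ (red 0)
    u : Q
    u = (a , false) · inv y
    rearrange : ∀ a z n → a + (z + n) + n + n ≡ a + n + z + (n + n)
    rearrange = solve-∀

  open CosetLabelling _·_ e inv inv-involutive inv-cancelʳ public

module CyclicSubgroup (n : ℕ) .{{_ : NonZero n}} (t : ℕ) .{{_ : NonZero t}}
                      (t∣N : t ∣ Dicyclic.N n) where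

  open Dicyclic n
  open DicyclicArithmetic n
  module ≋N = Congruence N
  open Congruence t

  H : Q → Set
  H = ⟨ pow x t ⟩

  label : Q → Bool × ℕ
  label g = proj₂ g , exp g % t

  mod-N⇒mod-t : ∀ {a b} → a ≋N.≋ b → a ≋ b
  mod-N⇒mod-t = ≋-weaken t∣N

  exp-e : exp e ≋ 0
  exp-e = mod-N⇒mod-t (exp-red 0)

  label-e : label e ≡ (false , 0)
  label-e = cong (false ,_) (trans exp-e (m<n⇒m%n≡m (>-nonZero⁻¹ t)))

  label-≡ : ∀ {g h} → proj₂ g ≡ proj₂ h → exp g ≋ exp h → label g ≡ label h
  label-≡ = cong₂ _,_

  H⇒label : ∀ {g} → H g → label g ≡ label e
  H⇒label (k , refl) = begin
    label (pow (pow x t) k)         ≡⟨ cong (λ g → label (pow g k)) (pow-x t) ⟩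
    label (pow (red t , false) k)   ≡⟨ cong label (pow-red t k) ⟩
    label (red (k * t) , false)     ≡⟨ label-≡ refl (trans (mod-N⇒mod-t (exp-red (k * t)))
                                         (trans (∣⇒≋0 (n∣m*n k)) (sym exp-e))) ⟩
    label e                         ∎
    where open ≡-Reasoning

  label⇒H : ∀ {g} → label g ≡ label e → H g
  label⇒H {a , b} eq with cong proj₁ eq
  ... | refl = toℕ a / t , (begin
    pow (pow x t) (toℕ a / t)        ≡⟨ cong (λ g → pow g (toℕ a / t)) (pow-x t) ⟩
    pow (red t , false) (toℕ a / t)  ≡⟨ pow-red t (toℕ a / t) ⟩
    (red (toℕ a / t * t) , false)    ≡⟨ cong (λ m → red m , false) (m/n*n≡m t∣a) ⟩
    (red (toℕ a) , false)            ≡⟨ exp-injective refl (exp-red (toℕ a)) ⟩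
    (a , false)                      ∎)
    where
    open ≡-Reasoning
    t∣a : t ∣ toℕ a
    t∣a = ≋0⇒∣ (trans (cong proj₂ eq) exp-e)

  label-translate : ∀ {c} w → H c → label (c · w) ≡ label w
  label-translate {a , b} w c∈H with cong proj₁ (H⇒label c∈H)
  ... | refl = label-≡ refl (begin
    exp ((a , false) · w)  ≈⟨ mod-N⇒mod-t (exp-·ˣ a w) ⟩
    toℕ a + exp w          ≈⟨ +-congʳ (exp w) (trans (cong proj₂ (H⇒label c∈H)) exp-e) ⟩
    exp w                  ∎)
    where open ≋-Reasoning

  label-coset : ∀ {g w} → label g ≡ label w → H (g · inv w)
  label-coset {a , b} {c , b′} eq with cong proj₁ eq
  label-coset {a , false} {c , false} eq | refl = label⇒H (label-≡ refl (begin
    exp ((a , false) · w⁻¹)  ≈⟨ mod-N⇒mod-t (exp-·ˣ a w⁻¹) ⟩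
    toℕ a + exp w⁻¹          ≈⟨ +-congʳ (exp w⁻¹) (cong proj₂ eq) ⟩
    toℕ c + exp w⁻¹          ≡⟨ +-comm (toℕ c) (exp w⁻¹) ⟩
    exp w⁻¹ + toℕ c          ≈⟨ mod-N⇒mod-t (exp-invˣ c) ⟩
    0                        ≈⟨ exp-e ⟨
    exp e                    ∎))
    where
    open ≋-Reasoning
    w⁻¹ : Q
    w⁻¹ = inv (c , false)
  label-coset {a , true} {c , true} eq | refl = label⇒H (label-≡ refl (trans
    (+-cancelʳ (toℕ c + n) (begin
      exp ((a , true) · w⁻¹) + (toℕ c + n)  ≈⟨ +-congˡ (exp ((a , true) · w⁻¹)) (mod-N⇒mod-t (exp-invʸ c)) ⟨
      exp ((a , true) · w⁻¹) + exp w⁻¹      ≈⟨ mod-N⇒mod-t (exp-·ʸʸ a (proj₁ w⁻¹)) ⟩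
      toℕ a + n                             ≈⟨ +-congʳ n (cong proj₂ eq) ⟩
      toℕ c + n                             ∎))
    (sym exp-e)))
    where
    open ≋-Reasoning
    w⁻¹ : Q
    w⁻¹ = inv (c , true)

  y∉H : ¬ H y
  y∉H y∈H with cong proj₁ (H⇒label y∈H)
  ... | ()

  n≉0 : ¬ n ≋N.≋ 0
  n≉0 n≋0 = ≢-nonZero⁻¹ n (trans (sym (m<n⇒m%n≡m n<N)) (trans n≋0 (m<n⇒m%n≡m (>-nonZero⁻¹ N))))
    where
    n<N : n < N
    n<N = m<m+n n (subst (0 <_) (sym (+-identityʳ n)) (>-nonZero⁻¹ n))

  ¬perfectCode : t ∣ n → ¬ IsPerfectCodeOfGroup H
  ¬perfectCode t∣n (S , S⁻¹⊆S , _ , perfect) with reflected-neighbour S⁻¹⊆S perfect y y∉H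
  ... | (a , b) , c∈H , reflection-is-c with cong proj₁ (H⇒label c∈H)
  ... | refl = n≉0 (≋N.+-cancelˡ (toℕ a) (begin
    toℕ a + n        ≈⟨ exp-red (toℕ a + n) ⟨
    exp c′           ≡⟨ cong exp c′≡c ⟩
    toℕ a            ≡⟨ +-identityʳ (toℕ a) ⟨
    toℕ a + 0        ∎))
    where
    open ≋N.≋-Reasoning
    a≋0 : toℕ a ≋ 0
    a≋0 = trans (cong proj₂ (H⇒label c∈H)) exp-e
    c′ : Q
    c′ = red (toℕ a + n) , false
    c′∈H : H c′
    c′∈H = label⇒H (label-≡ refl (trans (mod-N⇒mod-t (exp-red (toℕ a + n)))
             (trans (+-cong a≋0 (∣⇒≋0 t∣n)) (sym exp-e))))
    c′≡c : c′ ≡ (a , false)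
    c′≡c = trans (sym ([xᵃy⁻¹]⁻¹y≡xᵃ⁺ⁿ a)) (reflection-is-c (subst H (sym ([xᵃy⁻¹]⁻¹y≡xᵃ⁺ⁿ a)) c′∈H))

module OddQuotient (n : ℕ) .{{_ : NonZero n}} (t : ℕ) .{{_ : NonZero t}} (h q : ℕ)
                   (t≡h+h : t ≡ h + h) (n≡qt+h : n ≡ q * t + h) where

  open Dicyclic n
  open DicyclicArithmetic n

  t∣N : t ∣ N
  t∣N = divides (q + q + 1) (begin
    2 * n                    ≡⟨ cong (2 *_) n≡qt+h ⟩
    2 * (q * t + h)          ≡⟨ double q t h ⟩
    (q + q) * t + (h + h)    ≡⟨ cong ((q + q) * t +_) t≡h+h ⟨
    (q + q) * t + t          ≡⟨ collect q t ⟩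
    (q + q + 1) * t          ∎)
    where
    open ≡-Reasoning
    double : ∀ q t h → 2 * (q * t + h) ≡ (q + q) * t + (h + h)
    double = solve-∀
    collect : ∀ q t → (q + q) * t + t ≡ (q + q + 1) * t
    collect = solve-∀

  open CyclicSubgroup n t t∣N
  open Congruence t

  0<h : 0 < h
  0<h = n≢0⇒n>0 (λ h≡0 → ≢-nonZero⁻¹ t (trans t≡h+h (cong (λ m → m + m) h≡0)))

  h<t : h < t
  h<t = subst (h <_) (sym t≡h+h) (m<m+n h 0<h)

  t∸h≡h : t ∸ h ≡ h
  t∸h≡h = trans (cong (_∸ h) t≡h+h) (m+n∸m≡n h h)

  [n+[r∸h]]%t≡r : ∀ {r} → h ≤ r → r < t → (n + (r ∸ h)) % t ≡ r
  [n+[r∸h]]%t≡r {r} h≤r r<t = begin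
    (n + (r ∸ h)) % t          ≡⟨ cong (λ m → (m + (r ∸ h)) % t) (trans n≡qt+h (+-comm (q * t) h)) ⟩
    (h + q * t + (r ∸ h)) % t  ≡⟨ cong (_% t) (rearrange h (q * t) (r ∸ h)) ⟩
    (h + (r ∸ h) + q * t) % t  ≡⟨ cong (λ m → (m + q * t) % t) (m+[n∸m]≡n h≤r) ⟩
    (r + q * t) % t            ≡⟨ [m+kn]%n≡m%n r q t ⟩
    r % t                      ≡⟨ m<n⇒m%n≡m r<t ⟩
    r                          ∎
    where
    open ≡-Reasoning
    rearrange : ∀ h a b → h + a + b ≡ h + b + a
    rearrange = solve-∀

  n%t≡h : n % t ≡ h
  n%t≡h = trans (cong (_% t) (trans n≡qt+h (+-comm (q * t) h)))
                (trans ([m+kn]%n≡m%n h q t) (m<n⇒m%n≡m h<t))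

  label-xᵏ : ∀ k → label (pow x k) ≡ (false , k % t)
  label-xᵏ k = trans (cong label (pow-x k)) (cong (false ,_) (mod-N⇒mod-t (exp-red k)))

  label-xᵏy : ∀ k → label (pow x k · y) ≡ (true , k % t)
  label-xᵏy k = trans (cong label (pow-x·y k)) (cong (true ,_) (mod-N⇒mod-t (exp-red k)))

  label-x⁻ᵏ : ∀ {k} → k ≤ t → label (inv (pow x k)) ≡ (false , (t ∸ k) % t)
  label-x⁻ᵏ {k} k≤t = trans (cong (label ∘ inv) (pow-x k)) (cong (false ,_) (+-cancelʳ k (begin
    exp (inv (red k , false)) + k            ≈⟨ +-congˡ _ (mod-N⇒mod-t (exp-red k)) ⟨
    exp (inv (red k , false)) + toℕ (red k)  ≈⟨ mod-N⇒mod-t (exp-invˣ (red k)) ⟩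
    0                                        ≈⟨ ∸-inverse k≤t ⟨
    (t ∸ k) + k                              ∎)))
    where open ≋-Reasoning

  rep : Bool → ℕ → Q
  rep false r with <-cmp r h
  ... | tri< _ _ _ = pow x r
  ... | tri≈ _ _ _ = pow x n
  ... | tri> _ _ _ = inv (pow x (t ∸ r))
  rep true r with r <? h
  ... | yes _ = pow x r · y
  ... | no _  = pow x (n + (r ∸ h)) · y

  label-rep : ∀ b {r} → r < t → label (rep b r) ≡ (b , r)
  label-rep false {r} r<t with <-cmp r h
  ... | tri< _ _ _   = trans (label-xᵏ r) (cong (false ,_) (m<n⇒m%n≡m r<t))
  ... | tri≈ _ r≡h _ = trans (label-xᵏ n) (cong (false ,_) (trans n%t≡h (sym r≡h)))
  ... | tri> _ _ _   = trans (label-x⁻ᵏ (m∸n≤m t r))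
                         (cong (false ,_) (trans (cong (_% t) (m∸[m∸n]≡n (<⇒≤ r<t))) (m<n⇒m%n≡m r<t)))
  label-rep true {r} r<t with r <? h
  ... | yes _  = trans (label-xᵏy r) (cong (true ,_) (m<n⇒m%n≡m r<t))
  ... | no r≮h = trans (label-xᵏy (n + (r ∸ h))) (cong (true ,_) ([n+[r∸h]]%t≡r (≮⇒≥ r≮h) r<t))

  S : Q → Set
  S = Sset h

  nonzero-label : ∀ {b r} → 0 < r → (b , r) ≢ (false , 0)
  nonzero-label 0<r eq = <-irrefl refl (subst (0 <_) (cong proj₂ eq) 0<r)

  rep-∈S : ∀ b {r} → r < t → (b , r) ≢ (false , 0) → S (rep b r)
  rep-∈S false {r} r<t ≢0 with <-cmp r h
  ... | tri< r<h _ _ = inj₂ (inj₁ (r , n≢0⇒n>0 (≢0 ∘ cong (false ,_)) , r<h , inj₁ refl))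
  ... | tri≈ _ _ _   = inj₁ refl
  ... | tri> _ _ h<r = inj₂ (inj₁ (t ∸ r , m<n⇒0<n∸m r<t
                         , subst (t ∸ r <_) t∸h≡h (∸-monoʳ-< h<r (<⇒≤ r<t)) , inj₂ refl))
  rep-∈S true {r} r<t _ with r <? h
  ... | yes r<h = inj₂ (inj₂ (r , r<h , inj₁ refl))
  ... | no r≮h  = inj₂ (inj₂ (r ∸ h , subst (r ∸ h <_) t∸h≡h (∸-monoˡ-< r<t (≮⇒≥ r≮h)) , inj₂ refl))

  rep-false-< : ∀ {r} → r < h → rep false r ≡ pow x r
  rep-false-< {r} r<h with <-cmp r h
  ... | tri< _ _ _    = refl
  ... | tri≈ r≮h _ _  = contradiction r<h r≮h
  ... | tri> r≮h _ _  = contradiction r<h r≮h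

  rep-false-h : rep false h ≡ pow x n
  rep-false-h with <-cmp h h
  ... | tri< _ h≢h _  = contradiction refl h≢h
  ... | tri≈ _ _ _    = refl
  ... | tri> _ h≢h _  = contradiction refl h≢h

  rep-false-> : ∀ {r} → h < r → rep false r ≡ inv (pow x (t ∸ r))
  rep-false-> {r} h<r with <-cmp r h
  ... | tri< _ _ r≯h  = contradiction h<r r≯h
  ... | tri≈ _ _ r≯h  = contradiction h<r r≯h
  ... | tri> _ _ _    = refl

  rep-true-< : ∀ {r} → r < h → rep true r ≡ pow x r · y
  rep-true-< {r} r<h with r <? h
  ... | yes _  = refl
  ... | no r≮h = contradiction r<h r≮h

  rep-true-≥ : ∀ {r} → h ≤ r → rep true r ≡ pow x (n + (r ∸ h)) · y
  rep-true-≥ {r} h≤r with r <? h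
  ... | yes r<h = contradiction h≤r (<⇒≱ r<h)
  ... | no _    = refl

  S⇒rep : ∀ {s} → S s → ∃[ b ] ∃[ r ] (r < t × (b , r) ≢ (false , 0) × s ≡ rep b r)
  S⇒rep (inj₁ refl) = false , h , h<t , nonzero-label 0<h , sym rep-false-h
  S⇒rep (inj₂ (inj₁ (i , 0<i , i<h , inj₁ refl))) =
    false , i , <-trans i<h h<t , nonzero-label 0<i , sym (rep-false-< i<h)
  S⇒rep (inj₂ (inj₁ (i , 0<i , i<h , inj₂ refl))) =
    false , t ∸ i , ∸-monoʳ-< 0<i i≤t , nonzero-label (m<n⇒0<n∸m i<t) , sym (begin
      rep false (t ∸ i)            ≡⟨ rep-false-> (subst (_< t ∸ i) t∸h≡h (∸-monoʳ-< i<h (<⇒≤ h<t))) ⟩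
      inv (pow x (t ∸ (t ∸ i)))    ≡⟨ cong (inv ∘ pow x) (m∸[m∸n]≡n i≤t) ⟩
      inv (pow x i)                ∎)
    where
    open ≡-Reasoning
    i<t : i < t
    i<t = <-trans i<h h<t
    i≤t : i ≤ t
    i≤t = <⇒≤ i<t
  S⇒rep (inj₂ (inj₂ (i , i<h , inj₁ refl))) =
    true , i , <-trans i<h h<t , (λ ()) , sym (rep-true-< i<h)
  S⇒rep (inj₂ (inj₂ (i , i<h , inj₂ refl))) =
    true , h + i , subst (h + i <_) (sym t≡h+h) (+-monoʳ-< h i<h) , (λ ())
    , sym (trans (rep-true-≥ (m≤m+n h i)) (cong (λ m → pow x (n + m) · y) (m+n∸m≡n h i)))

  S⁻¹⊆S : InverseClosed S
  S⁻¹⊆S _ (inj₁ refl) = inj₁ inv-xⁿ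
  S⁻¹⊆S _ (inj₂ (inj₁ (i , 0<i , i<h , inj₁ refl))) = inj₂ (inj₁ (i , 0<i , i<h , inj₂ refl))
  S⁻¹⊆S _ (inj₂ (inj₁ (i , 0<i , i<h , inj₂ refl))) = inj₂ (inj₁ (i , 0<i , i<h , inj₁ (inv-involutive _)))
  S⁻¹⊆S _ (inj₂ (inj₂ (i , i<h , inj₁ refl))) = inj₂ (inj₂ (i , i<h , inj₂ (inv-xᵏy i)))
  S⁻¹⊆S _ (inj₂ (inj₂ (i , i<h , inj₂ refl))) =
    inj₂ (inj₂ (i , i<h , inj₁ (trans (cong inv (sym (inv-xᵏy i))) (inv-involutive _))))

  label-S : ∀ {s} → S s → label s ≢ label e
  label-S s∈S with S⇒rep s∈S
  ... | b , r , r<t , ≢0 , refl = λ eq → ≢0 (trans (sym (label-rep b r<t)) (trans eq label-e))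

  label-injective-on-S : ∀ {s s′} → S s → S s′ → label s ≡ label s′ → s ≡ s′
  label-injective-on-S s∈S s′∈S eq with S⇒rep s∈S | S⇒rep s′∈S
  ... | b , r , r<t , _ , refl | b′ , r′ , r′<t , _ , refl =
    cong (λ (b , r) → rep b r) (trans (sym (label-rep b r<t)) (trans eq (label-rep b′ r′<t)))

  label-surjective-on-S : ∀ w → label w ≢ label e → ∃[ s ] (S s × label s ≡ label w)
  label-surjective-on-S (a , b) ≢e = rep b r , rep-∈S b r<t (λ eq → ≢e (trans eq (sym label-e)))
                                   , label-rep b r<t
    where
    r : ℕ
    r = toℕ a % t
    r<t : r < t
    r<t = m%n<n (toℕ a) t

  open Labelling label H⇒label label⇒H label-translate label-coset
                 label-S label-injective-on-S label-surjective-on-S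
    using (e∉S; isPerfectCode)

  S-perfectCode : IsPerfectCode S H
  S-perfectCode = isPerfectCode

  H-perfectCode : IsPerfectCodeOfGroup H
  H-perfectCode = S , S⁻¹⊆S , e∉S , S-perfectCode

lemma5p1 : (n : ℕ) .{{_ : NonZero n}} → 2 ≤ n →
    (t : ℕ) .{{_ : NonZero t}} → t ∣ 2 * n →
      (Dicyclic.IsPerfectCodeOfGroup n (Dicyclic.⟨_⟩ n (Dicyclic.pow n (Dicyclic.x n) t))
        ⇔ (¬ 2 ∣ (2 * n) / t))
      × (¬ 2 ∣ (2 * n) / t →
          Dicyclic.IsPerfectCode n (Dicyclic.Sset n (t / 2))
            (Dicyclic.⟨_⟩ n (Dicyclic.pow n (Dicyclic.x n) t)))
lemma5p1 n _ t t∣2n = mk⇔ even⇒¬perfect (proj₁ ∘ odd⇒perfect) , proj₂ ∘ odd⇒perfect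
  where
  open Dicyclic n
  open CyclicSubgroup n t t∣2n using (H; ¬perfectCode)
  m : ℕ
  m = quotient t∣2n
  2n≡mt : 2 * n ≡ m * t
  2n≡mt = m∣n⇒n≡quotient*m t∣2n
  2n/t≡m : (2 * n) / t ≡ m
  2n/t≡m = n/m≡quotient t∣2n
  even⇒¬perfect : IsPerfectCodeOfGroup H → ¬ 2 ∣ (2 * n) / t
  even⇒¬perfect perfect 2∣2n/t =
    ¬perfectCode (even-quotient n t m 2n≡mt (subst (2 ∣_) 2n/t≡m 2∣2n/t)) perfect
  odd⇒perfect : ¬ 2 ∣ (2 * n) / t → IsPerfectCodeOfGroup H × IsPerfectCode (Sset (t / 2)) H
  odd⇒perfect 2∤2n/t with odd-quotient n t m 2n≡mt (2∤2n/t ∘ subst (2 ∣_) (sym 2n/t≡m))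
  ... | h , q , t≡h+h , n≡qt+h =
    H-perfectCode , subst (λ k → IsPerfectCode (Sset k) H) h≡t/2 S-perfectCode
    where
    open OddQuotient n t h q t≡h+h n≡qt+h using (H-perfectCode; S-perfectCode)
    h≡t/2 : h ≡ t / 2
    h≡t/2 = sym (trans (cong (_/ 2) t≡h+h) ([h+h]/2≡h h))
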